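{- If $G$ is a distance-hereditary graph, then $\gamma_{\rm wcon}(G)=\gamma_c(G)$.
   Context: A distance-hereditary graph is a connected graph in which every connected induced subgraph is isometric, i.e. distances between its vertices equal their distances in the whole graph. A set $D$ is dominating if every vertex outside $D$ has a neighbour in $D$; connected dominating if also $G[D]$ is connected; weakly convex if for any $a,b\in D$ some shortest $(a-b)$-path in $G$ lies in $D$. $\gamma_c(G)$, $\gamma_{\rm wcon}(G)$ denote the minimum sizes of a connected dominating set and a weakly convex dominating set. -}

module Defs where

open import Data.Nat using (ℕ; zero; suc; _≤_)
open import Data.Fin using (Fin)
open import Data.Fin.Subset using (Subset; _∈_; ⊤; ∣_∣)
open import Data.Product using (Σ; ∃; _×_; _,_)
open import Relation.Nullary using (¬_; Dec)
open import Relation.Binary.PropositionalEquality using (_≡_)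

record Graph (n : ℕ) : Set₁ where
  field
    Adj     : Fin n → Fin n → Set
    adj?    : ∀ u v → Dec (Adj u v)
    sym     : ∀ {u v} → Adj u v → Adj v u
    irrefl  : ∀ {u} → ¬ Adj u u
open Graph public

-- WalkIn G S u v k : a walk from u to v with k edges, all of whose
-- vertices lie in S (i.e. a walk in the induced subgraph G[S]).
data WalkIn {n : ℕ} (G : Graph n) (S : Subset n) : Fin n → Fin n → ℕ → Set where
  here : ∀ {u} → u ∈ S → WalkIn G S u u zero
  step : ∀ {u w v k} → u ∈ S → Adj G u w → WalkIn G S w v k → WalkIn G S u v (suc k)

IsDistIn : {n : ℕ} → Graph n → Subset n → Fin n → Fin n → ℕ → Set
IsDistIn G S u v d = WalkIn G S u v d × (∀ k → WalkIn G S u v k → d ≤ k)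

IsDist : {n : ℕ} → Graph n → Fin n → Fin n → ℕ → Set
IsDist G = IsDistIn G ⊤

-- G[S] is connected (connected graphs are nonempty).
ConnectedIn : {n : ℕ} → Graph n → Subset n → Set
ConnectedIn G S = (∃ λ v → v ∈ S) × (∀ u v → u ∈ S → v ∈ S → ∃ λ k → WalkIn G S u v k)

Connected : {n : ℕ} → Graph n → Set
Connected G = ConnectedIn G ⊤

Isometric : {n : ℕ} → Graph n → Subset n → Set
Isometric G S = ∀ u v → u ∈ S → v ∈ S → ∀ d → IsDist G u v d → IsDistIn G S u v d

DistanceHereditary : {n : ℕ} → Graph n → Set
DistanceHereditary {n} G = Connected G × (∀ (S : Subset n) → ConnectedIn G S → Isometric G S)

Dominating : {n : ℕ} → Graph n → Subset n → Set
Dominating G D = ∀ v → ¬ (v ∈ D) → ∃ λ u → u ∈ D × Adj G v u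

ConnectedDominating : {n : ℕ} → Graph n → Subset n → Set
ConnectedDominating G D = Dominating G D × ConnectedIn G D

WeaklyConvex : {n : ℕ} → Graph n → Subset n → Set
WeaklyConvex G D = ∀ a b → a ∈ D → b ∈ D → ∃ λ d → IsDist G a b d × WalkIn G D a b d

WeaklyConvexDominating : {n : ℕ} → Graph n → Subset n → Set
WeaklyConvexDominating G D = Dominating G D × WeaklyConvex G D

IsMinSize : {n : ℕ} → (Subset n → Set) → ℕ → Set
IsMinSize {n} P k = (∃ λ (D : Subset n) → P D × ∣ D ∣ ≡ k) × (∀ (D : Subset n) → P D → k ≤ ∣ D ∣)

γc≡ : {n : ℕ} → Graph n → ℕ → Set
γc≡ G = IsMinSize (ConnectedDominating G)

γwcon≡ : {n : ℕ} → Graph n → ℕ → Set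
γwcon≡ G = IsMinSize (WeaklyConvexDominating G)

-- In a distance-hereditary graph every connected set D induces an isometric
-- subgraph, so a shortest path of G[D] between two vertices of D is already a
-- shortest path of G: connected dominating sets are weakly convex.  Conversely,
-- a weakly convex set is connected, and a dominating set of a nonempty graph is
-- nonempty.  The two families of sets therefore coincide, and so do their
-- minimum sizes.
module Submission where

open import Defs
open import Data.Nat using (ℕ; zero; suc; _<_; _≤_)
open import Data.Nat.Properties using (≮⇒≥; anyUpTo?)
open import Data.Nat.Induction using (<-rec)
open import Data.Product using (_×_; _,_; ∃; proj₁)
open import Data.Fin using (Fin; _≟_)
open import Data.Fin.Properties using (any?)
open import Data.Fin.Subset using (Subset; _∈_)
open import Data.Fin.Subset.Properties using (∈⊤; _∈?_)
open import Relation.Nullary using (Dec; yes; no)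
open import Relation.Nullary.Decidable using (_×-dec_)
open import Relation.Unary using (Decidable)
open import Relation.Binary.PropositionalEquality using (refl)

module _ {P : ℕ → Set} (P? : Decidable P) where

  Least : Set
  Least = ∃ λ d → P d × (∀ k → P k → d ≤ k)

  least-witness : ∀ {m} → P m → Least
  least-witness {m} = <-rec (λ m → P m → Least) search m
    where
    search : ∀ m → (∀ {j} → j < m → P j → Least) → P m → Least
    search m smaller-search Pm with anyUpTo? P? m
    ... | yes (j , j<m , Pj) = smaller-search j<m Pj
    ... | no ¬smaller        = m , Pm , λ k Pk → ≮⇒≥ (λ k<m → ¬smaller (k , k<m , Pk))

module _ {n : ℕ} (G : Graph n) where

  walkIn? : ∀ S k u v → Dec (WalkIn G S u v k)
  walkIn? S zero u v with u ≟ v | u ∈? S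
  ... | yes refl | yes u∈S = yes (here u∈S)
  ... | yes refl | no u∉S  = no λ { (here u∈S) → u∉S u∈S }
  ... | no u≢v   | _       = no λ { (here _) → u≢v refl }
  walkIn? S (suc k) u v with u ∈? S ×-dec any? (λ w → adj? G u w ×-dec walkIn? S k w v)
  ... | yes (u∈S , w , uw , p) = yes (step u∈S uw p)
  ... | no ¬step               = no λ { (step u∈S uw p) → ¬step (u∈S , _ , uw , p) }

  walkIn⇒distIn : ∀ {S u v k} → WalkIn G S u v k → ∃ (IsDistIn G S u v)
  walkIn⇒distIn {S} {u} {v} = least-witness (λ k → walkIn? S k u v)

  connected⇒dist : Connected G → ∀ u v → ∃ (IsDist G u v)
  connected⇒dist (_ , reach) u v with reach u v ∈⊤ ∈⊤
  ... | _ , p = walkIn⇒distIn p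

  isometric⇒weaklyConvex : Connected G → ∀ {D} → Isometric G D → WeaklyConvex G D
  isometric⇒weaklyConvex conn iso a b a∈D b∈D with connected⇒dist conn a b
  ... | d , dist-ab = d , dist-ab , proj₁ (iso a b a∈D b∈D d dist-ab)

  weaklyConvex⇒connectedIn : ∀ {D} → ∃ (_∈ D) → WeaklyConvex G D → ConnectedIn G D
  weaklyConvex⇒connectedIn inhabited wc = inhabited , λ a b a∈D b∈D →
    let d , _ , p = wc a b a∈D b∈D in d , p

  dominating⇒inhabited : ∀ {D} → Dominating G D → Fin n → ∃ (_∈ D)
  dominating⇒inhabited {D} dom v with v ∈? D
  ... | yes v∈D = v , v∈D
  ... | no v∉D  = let u , u∈D , _ = dom v v∉D in u , u∈D

  connectedDominating⇒weaklyConvexDominating : DistanceHereditary G →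
    ∀ D → ConnectedDominating G D → WeaklyConvexDominating G D
  connectedDominating⇒weaklyConvexDominating (conn , hereditary) D (dom , connD) =
    dom , isometric⇒weaklyConvex conn (hereditary D connD)

  weaklyConvexDominating⇒connectedDominating : Connected G →
    ∀ D → WeaklyConvexDominating G D → ConnectedDominating G D
  weaklyConvexDominating⇒connectedDominating ((v , _) , _) D (dom , wc) =
    dom , weaklyConvex⇒connectedIn (dominating⇒inhabited dom v) wc

IsMinSize-resp : ∀ {n} {P Q : Subset n → Set} → (∀ D → P D → Q D) → (∀ D → Q D → P D)
               → ∀ {k} → IsMinSize P k → IsMinSize Q k
IsMinSize-resp P⇒Q Q⇒P ((D , PD , size) , minimal) =
  (D , P⇒Q D PD , size) , λ D′ QD′ → minimal D′ (Q⇒P D′ QD′)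

lemma3p2 : ∀ {n : ℕ} (G : Graph n) → DistanceHereditary G →
    ∀ (k : ℕ) → (γwcon≡ G k → γc≡ G k) × (γc≡ G k → γwcon≡ G k)
lemma3p2 G dh@(conn , _) k =
  IsMinSize-resp wcd⇒cd cd⇒wcd , IsMinSize-resp cd⇒wcd wcd⇒cd
  where
  cd⇒wcd : ∀ D → ConnectedDominating G D → WeaklyConvexDominating G D
  cd⇒wcd = connectedDominating⇒weaklyConvexDominating G dh

  wcd⇒cd : ∀ D → WeaklyConvexDominating G D → ConnectedDominating G D
  wcd⇒cd = weaklyConvexDominating⇒connectedDominating G conn
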